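{- Let $X$ be a nonempty set, $n\ge1$, and $\mathcal{U}$ a family of subsets of $X$. Then $\mathcal{U}$ is $n$-minimal constructible if and only if for every $A\in\mathcal{U}$ we have $\mathcal{U}\not\subseteq C_n(\mathcal{U}\setminus\{A\})$.
   Context: For a family $\mathcal{U}$ of subsets of $X$, let $C_1(\mathcal{U})$ be the family of all sets of the form $E_1\cap E_2$, $E_1\cup E_2$ or $X\setminus E_1$ with $E_1,E_2\in\mathcal{U}$ (possibly $E_1=E_2$). Set $C_0(\mathcal{U})=\mathcal{U}$ and $C_n(\mathcal{U})=C_1(C_{n-1}(\mathcal{U}))$ for $n\ge1$. A family $\mathcal{U}$ is $n$-minimal constructible ($n\ge1$) if for every proper subfamily $\mathcal{H}\subsetneq\mathcal{U}$ we have $\mathcal{U}\not\subseteq C_n(\mathcal{H})$. -}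

module Defs where

open import Data.Nat using (ℕ; zero; suc)
open import Data.Product using (Σ; _×_; ∃-syntax)
open import Data.Sum using (_⊎_)
open import Relation.Nullary using (¬_)

Subset : Set → Set₁
Subset X = X → Set

_≐_ : {X : Set} → Subset X → Subset X → Set
_≐_ {X} A B = (x : X) → (A x → B x) × (B x → A x)

_∩_ : {X : Set} → Subset X → Subset X → Subset X
(A ∩ B) x = A x × B x

_∪_ : {X : Set} → Subset X → Subset X → Subset X
(A ∪ B) x = A x ⊎ B x

compl : {X : Set} → Subset X → Subset X
compl A x = ¬ A x

Family : Set → Set₂
Family X = Subset X → Set₁

-- Membership in a family, up to extensional equality of subsets.
_∈F_ : {X : Set} → Subset X → Family X → Set₁
_∈F_ {X} S 𝒰 = ∃[ T ] (𝒰 T × (S ≐ T))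

_⊆F_ : {X : Set} → Family X → Family X → Set₁
_⊆F_ {X} 𝒰 𝒱 = (S : Subset X) → S ∈F 𝒰 → S ∈F 𝒱

_⊊F_ : {X : Set} → Family X → Family X → Set₁
ℋ ⊊F 𝒰 = (ℋ ⊆F 𝒰) × (∃[ A ] (A ∈F 𝒰 × ¬ (A ∈F ℋ)))

_∖F_ : {X : Set} → Family X → Subset X → Family X
(𝒰 ∖F A) B = 𝒰 B × ¬ (B ≐ A)

C₁ : {X : Set} → Family X → Family X
C₁ {X} 𝒰 S = Σ (Subset X) λ E₁ → Σ (Subset X) λ E₂ →
  𝒰 E₁ × 𝒰 E₂ × ((S ≐ (E₁ ∩ E₂)) ⊎ ((S ≐ (E₁ ∪ E₂)) ⊎ (S ≐ compl E₁)))

C : {X : Set} → ℕ → Family X → Family X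
C zero 𝒰 = 𝒰
C (suc n) 𝒰 = C₁ (C n 𝒰)

MinimalConstructible : {X : Set} → ℕ → Family X → Set₂
MinimalConstructible {X} n 𝒰 = (ℋ : Family X) → ℋ ⊊F 𝒰 → ¬ (𝒰 ⊆F C n ℋ)

-- A proper subfamily ℋ ⊊ 𝒰 misses some A ∈ 𝒰, so ℋ ⊆ 𝒰 ∖ {A}; since C n is monotone,
-- C n ℋ ⊆ C n (𝒰 ∖ {A}). Hence it suffices to test the subfamilies 𝒰 ∖ {A}, which are
-- themselves proper.
module Submission where

open import Defs
open import Data.Nat using (ℕ; _≤_; zero; suc)
open import Data.Product using (_,_; proj₁; proj₂)
open import Data.Sum using (_⊎_; inj₁; inj₂; [_,_])
open import Function.Bundles using (_⇔_; mk⇔)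
open import Relation.Nullary using (¬_)

module _ {X : Set} where

  ≐-refl : {A : Subset X} → A ≐ A
  ≐-refl x = (λ a → a) , (λ a → a)

  ≐-sym : {A B : Subset X} → A ≐ B → B ≐ A
  ≐-sym p x = proj₂ (p x) , proj₁ (p x)

  ≐-trans : {A B D : Subset X} → A ≐ B → B ≐ D → A ≐ D
  ≐-trans p q x = (λ a → proj₁ (q x) (proj₁ (p x) a)) , (λ d → proj₂ (p x) (proj₂ (q x) d))

  ∩-cong : {A B A′ B′ : Subset X} → A ≐ A′ → B ≐ B′ → (A ∩ B) ≐ (A′ ∩ B′)
  ∩-cong p q x = (λ { (a , b) → proj₁ (p x) a , proj₁ (q x) b })
               , (λ { (a , b) → proj₂ (p x) a , proj₂ (q x) b })

  ∪-cong : {A B A′ B′ : Subset X} → A ≐ A′ → B ≐ B′ → (A ∪ B) ≐ (A′ ∪ B′)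
  ∪-cong p q x = [ (λ a → inj₁ (proj₁ (p x) a)) , (λ b → inj₂ (proj₁ (q x) b)) ]
               , [ (λ a → inj₁ (proj₂ (p x) a)) , (λ b → inj₂ (proj₂ (q x) b)) ]

  compl-cong : {A A′ : Subset X} → A ≐ A′ → compl A ≐ compl A′
  compl-cong p x = (λ ¬a a → ¬a (proj₂ (p x) a)) , (λ ¬a a → ¬a (proj₁ (p x) a))

  ∈F-self : {F : Family X} {S : Subset X} → F S → S ∈F F
  ∈F-self {S = S} s = S , s , ≐-refl

  ∈F-resp-≐ : {F : Family X} {S T : Subset X} → S ≐ T → T ∈F F → S ∈F F
  ∈F-resp-≐ e (U , u , e′) = U , u , ≐-trans e e′

  ⊆F-trans : {F G H : Family X} → F ⊆F G → G ⊆F H → F ⊆F H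
  ⊆F-trans p q S s = q S (p S s)

  C₁-mono : {F G : Family X} → F ⊆F G → C₁ F ⊆F C₁ G
  C₁-mono p S (T , (E₁ , E₂ , f₁ , f₂ , shape) , S≐T)
    with p E₁ (∈F-self f₁) | p E₂ (∈F-self f₂)
  ... | E₁′ , g₁ , e₁ | E₂′ , g₂ , e₂ = ∈F-resp-≐ S≐T (∈F-self (E₁′ , E₂′ , g₁ , g₂ , shape′))
    where
    shape′ : (T ≐ (E₁′ ∩ E₂′)) ⊎ ((T ≐ (E₁′ ∪ E₂′)) ⊎ (T ≐ compl E₁′))
    shape′ = [ (λ s → inj₁ (≐-trans s (∩-cong e₁ e₂)))
             , [ (λ s → inj₂ (inj₁ (≐-trans s (∪-cong e₁ e₂))))
               , (λ s → inj₂ (inj₂ (≐-trans s (compl-cong e₁)))) ] ] shape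

  C-mono : (n : ℕ) {F G : Family X} → F ⊆F G → C n F ⊆F C n G
  C-mono zero    p = p
  C-mono (suc n) p = C₁-mono (C-mono n p)

  ∖F-⊆F : (𝒰 : Family X) (A : Subset X) → (𝒰 ∖F A) ⊆F 𝒰
  ∖F-⊆F 𝒰 A S (T , (u , _) , S≐T) = T , u , S≐T

  ∉-∖F : (𝒰 : Family X) (A : Subset X) → ¬ (A ∈F (𝒰 ∖F A))
  ∉-∖F 𝒰 A (T , (_ , T≉A) , A≐T) = T≉A (≐-sym A≐T)

  ∖F-⊊F : (𝒰 : Family X) {A : Subset X} → A ∈F 𝒰 → (𝒰 ∖F A) ⊊F 𝒰
  ∖F-⊊F 𝒰 {A} A∈𝒰 = ∖F-⊆F 𝒰 A , A , A∈𝒰 , ∉-∖F 𝒰 A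

  ⊆F-∖F : {ℋ 𝒰 : Family X} {A : Subset X} → ℋ ⊆F 𝒰 → ¬ (A ∈F ℋ) → ℋ ⊆F (𝒰 ∖F A)
  ⊆F-∖F ℋ⊆𝒰 A∉ℋ S S∈ℋ with ℋ⊆𝒰 S S∈ℋ
  ... | T , u , S≐T = T , (u , λ T≐A → A∉ℋ (∈F-resp-≐ (≐-sym (≐-trans S≐T T≐A)) S∈ℋ)) , S≐T

lemma6p6 : (X : Set) → X → (n : ℕ) → 1 ≤ n → (𝒰 : Family X) →
    MinimalConstructible n 𝒰 ⇔ ((A : Subset X) → A ∈F 𝒰 → ¬ (𝒰 ⊆F C n (𝒰 ∖F A)))
lemma6p6 X _ n _ 𝒰 = mk⇔ to from
  where
  to : MinimalConstructible n 𝒰 → (A : Subset X) → A ∈F 𝒰 → ¬ (𝒰 ⊆F C n (𝒰 ∖F A))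
  to minimal A A∈𝒰 = minimal (𝒰 ∖F A) (∖F-⊊F 𝒰 A∈𝒰)

  from : ((A : Subset X) → A ∈F 𝒰 → ¬ (𝒰 ⊆F C n (𝒰 ∖F A))) → MinimalConstructible n 𝒰
  from irredundant ℋ (ℋ⊆𝒰 , A , A∈𝒰 , A∉ℋ) 𝒰⊆Cℋ =
    irredundant A A∈𝒰 (⊆F-trans 𝒰⊆Cℋ (C-mono n (⊆F-∖F ℋ⊆𝒰 A∉ℋ)))
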